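{- Let $S$ be a degree-greedy stable set in a diamond-free graph $G$. Then $G$ is edge simplicial if and only if the multigraph $G_S$ equals $G-S$ (as multigraphs, i.e., same vertex set and same multiset of edges).
   Context: Graphs are finite and simple unless called multigraphs. The diamond is $K_4$ minus an edge; diamond-free means no induced diamond. A vertex $v$ is simplicial if $N[v]$ is a clique; a simplicial clique is a clique equal to $N[v]$ for some simplicial vertex $v$. $G$ is edge simplicial if every edge of $G$ is contained in a simplicial clique. For a linear ordering $\sigma=(v_1,\dots,v_n)$ of $V(G)$, the $\sigma$-greedy stable set is obtained by scanning $v_1,\dots,v_n$ in order, starting from $\emptyset$, adding $v_i$ whenever the set stays stable; a degree-greedy stable set is a $\sigma$-greedy stable set for some $\sigma$ with $d_G(v_i)\le d_G(v_j)$ for $i<j$. For a stable set $S$ of $G=(V,E)$, $G_S$ is the multigraph with vertex set $V\setminus S$ and edge multiset $\biguplus_{v\in S}\{xy : x\neq y,\ x,y\in N_G(v)\}$ (each pair contributed once per such $v$, with multiplicity). -}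

module Defs where

open import Data.Nat using (ℕ; _≤_)
open import Data.Bool using (Bool; true; false; if_then_else_; _∧_; not)
open import Data.Fin using (Fin)
open import Data.List using (List; allFin; foldl; map)
open import Data.Nat.ListAction using (sum)
open import Data.Bool.ListAction using (any)
open import Relation.Nullary using (does)
open import Data.Fin using (_≟_)
open import Data.List.Relation.Binary.Permutation.Propositional using (_↭_)
open import Data.List.Relation.Unary.AllPairs using (AllPairs)
open import Data.Product using (Σ; _×_; ∃)
open import Data.Sum using (_⊎_)
open import Relation.Nullary using (¬_)
open import Relation.Binary.PropositionalEquality using (_≡_; _≢_)

record Graph (n : ℕ) : Set where
  field
    adj    : Fin n → Fin n → Bool
    sym    : ∀ x y → adj x y ≡ adj y x
    irrefl : ∀ x → adj x x ≡ false

module _ {n : ℕ} (G : Graph n) where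
  open Graph G

  Adj : Fin n → Fin n → Set
  Adj x y = adj x y ≡ true

  countB : (Fin n → Bool) → ℕ
  countB f = sum (map (λ v → if f v then 1 else 0) (allFin n))

  degree : Fin n → ℕ
  degree v = countB (adj v)

  InClosedNbhd : Fin n → Fin n → Set
  InClosedNbhd v x = x ≡ v ⊎ Adj v x

  Simplicial : Fin n → Set
  Simplicial v = ∀ x y → InClosedNbhd v x → InClosedNbhd v y → x ≢ y → Adj x y

  -- every edge lies in a simplicial clique, i.e. in N[v] for some simplicial v
  EdgeSimplicial : Set
  EdgeSimplicial = ∀ x y → Adj x y →
    ∃ λ v → Simplicial v × InClosedNbhd v x × InClosedNbhd v y

  InducedDiamond : Fin n → Fin n → Fin n → Fin n → Set
  InducedDiamond a b c d =
    Adj a b × Adj a c × Adj a d × Adj b c × Adj b d × c ≢ d × ¬ Adj c d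

  DiamondFree : Set
  DiamondFree = ∀ a b c d → ¬ InducedDiamond a b c d

  VSet : Set
  VSet = Fin n → Bool

  ∅ : VSet
  ∅ _ = false

  hasNbrIn : VSet → Fin n → Bool
  hasNbrIn S v = any (λ u → S u ∧ adj v u) (allFin n)

  insert : VSet → Fin n → VSet
  insert S v u = if S u then true else does (u ≟ v)

  greedyStep : VSet → Fin n → VSet
  greedyStep S v = if hasNbrIn S v then S else insert S v

  greedy : List (Fin n) → VSet
  greedy σ = foldl greedyStep ∅ σ

  DegreeGreedy : VSet → Set
  DegreeGreedy S = ∃ λ (σ : List (Fin n)) →
    σ ↭ allFin n × AllPairs (λ u v → degree u ≤ degree v) σ × (∀ x → S x ≡ greedy σ x)

  GS-mult : VSet → Fin n → Fin n → ℕ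
  GS-mult S x y = countB (λ v → S v ∧ adj v x ∧ adj v y)

  minus-mult : VSet → Fin n → Fin n → ℕ
  minus-mult S x y = if adj x y then 1 else 0

  -- G_S = G - S as multigraphs: both have vertex set V \ S; equal edge multiplicities
  -- for every pair of distinct vertices of V \ S.
  GS≡G-S : VSet → Set
  GS≡G-S S = ∀ x y → S x ≡ false → S y ≡ false → x ≢ y → GS-mult S x y ≡ minus-mult S x y

{-# OPTIONS --safe #-}
-- Scanning vertices by non-decreasing degree, the greedy stable set S is
-- maximal, and moreover every vertex w of degree smaller than some v ∈ S is
-- dominated by S − v: w was scanned before v, and at that moment it was in S
-- or had a neighbour in S, which cannot be v.
--
-- If G is edge simplicial, every v ∈ S is simplicial: otherwise v has
-- non-adjacent neighbours x, y, and the simplicial clique N[w] containing vx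
-- satisfies N[w] ⊊ N[v] (y ∉ N[w]), so deg w < deg v; then a member of S − v
-- lies in N[w] ⊆ N[v], against stability.  Hence non-adjacent x, y outside S
-- have no common neighbour in S; adjacent ones have at least one (through the
-- simplicial clique of xy and maximality of S) and at most one, since two
-- would induce a diamond with x and y.
--
-- Conversely, if G_S = G − S, a member v ∈ S with non-adjacent neighbours
-- x, y would give the non-edge xy positive multiplicity, so every v ∈ S is
-- simplicial, and every edge outside S has a common neighbour v ∈ S, lying
-- in the simplicial clique N[v].
module Submission where

open import Defs
open import Data.Nat using (ℕ; suc; _+_; _≤_; _<_; z≤n; s≤s; s<s⁻¹)
open import Data.Nat.Properties
  using (≤-refl; ≤-reflexive; ≤-antisym; ≤⇒≯; +-mono-≤; +-mono-<-≤; +-mono-≤-<; +-commutativeSemigroup)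
open import Algebra.Properties.CommutativeSemigroup +-commutativeSemigroup using (interchange)
open import Data.Bool using (Bool; true; false; if_then_else_; _∧_; _∨_)
open import Data.Bool.Properties using (∨-zeroʳ; ¬-not; T-≡)
import Data.Bool.Properties as Bool
open import Data.Fin using (Fin; _≟_)
open import Data.List using (List; []; _∷_; allFin; map; foldl)
open import Data.Nat.ListAction using (sum)
open import Data.List.Membership.Propositional using (_∈_; lose)
open import Data.List.Membership.Propositional.Properties using (∈-allFin)
open import Data.List.Relation.Unary.Any using (here; there; satisfied)
open import Data.List.Relation.Unary.Any.Properties using (any⁺; any⁻)
import Data.List.Relation.Unary.All as All
open import Data.List.Relation.Unary.All using (All)
open import Data.List.Relation.Unary.AllPairs using (AllPairs; _∷_)
open import Data.List.Relation.Unary.Unique.Propositional using (Unique)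
open import Data.List.Relation.Unary.Unique.Propositional.Properties using (allFin⁺)
open import Data.List.Relation.Binary.Permutation.Propositional using (_↭_; ↭-sym)
open import Data.List.Relation.Binary.Permutation.Propositional.Properties using (∈-resp-↭)
open import Data.Product using (_×_; ∃; _,_)
open import Data.Sum using (_⊎_; inj₁; inj₂; map₁)
open import Function.Bundles using (_⇔_; mk⇔; Equivalence)
open import Relation.Nullary using (¬_; Dec; does; yes; no; contradiction)
open import Relation.Nullary.Decidable using (dec-true; decidable-stable)
open import Relation.Binary.PropositionalEquality using (_≡_; _≢_; refl; sym; trans; cong; cong₂; subst; subst₂; ≢-sym)

does-true⁻ : ∀ {A : Set} (a? : Dec A) → does a? ≡ true → A
does-true⁻ (yes a) _ = a

∧-true⁺ : ∀ {a b} → a ≡ true → b ≡ true → a ∧ b ≡ true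
∧-true⁺ refl refl = refl

∧-true⁻ : ∀ {a b} → a ∧ b ≡ true → a ≡ true × b ≡ true
∧-true⁻ {true} {true} refl = refl , refl

indicator : Bool → ℕ
indicator b = if b then 1 else 0

indicator-mono : ∀ {a b} → (a ≡ true → b ≡ true) → indicator a ≤ indicator b
indicator-mono {false} _ = z≤n
indicator-mono {true} a⇒b rewrite a⇒b refl = ≤-refl

indicator-< : ∀ {a b} → a ≡ false → b ≡ true → indicator a < indicator b
indicator-< refl refl = s≤s z≤n

indicator-∨ : ∀ a b → a ∧ b ≡ false → indicator (a ∨ b) ≡ indicator a + indicator b
indicator-∨ true false _ = refl
indicator-∨ false b _ = refl

module _ {A : Set} where

  count : (A → Bool) → List A → ℕ
  count f xs = sum (map (λ u → indicator (f u)) xs)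

  count-mono : ∀ {f g} → (∀ u → f u ≡ true → g u ≡ true) → ∀ xs → count f xs ≤ count g xs
  count-mono f⇒g [] = z≤n
  count-mono f⇒g (x ∷ xs) = +-mono-≤ (indicator-mono (f⇒g x)) (count-mono f⇒g xs)

  count-< : ∀ {f g u xs} → (∀ u → f u ≡ true → g u ≡ true) →
            u ∈ xs → f u ≡ false → g u ≡ true → count f xs < count g xs
  count-< {xs = _ ∷ xs} f⇒g (here refl) fu gu = +-mono-<-≤ (indicator-< fu gu) (count-mono f⇒g xs)
  count-< {xs = x ∷ _} f⇒g (there u∈xs) fu gu =
    +-mono-≤-< (indicator-mono (f⇒g x)) (count-< f⇒g u∈xs fu gu)

  count-pos : ∀ {f u xs} → u ∈ xs → f u ≡ true → 0 < count f xs
  count-pos (here refl) fu = +-mono-<-≤ (indicator-< {false} refl fu) z≤n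
  count-pos (there u∈xs) fu = +-mono-≤-< z≤n (count-pos u∈xs fu)

  count-witness : ∀ {f} xs → 0 < count f xs → ∃ λ u → f u ≡ true
  count-witness {f} (x ∷ xs) pos with f x in fx
  ... | true = x , fx
  ... | false = count-witness xs pos

  count-zero : ∀ {f} xs → (∀ u → u ∈ xs → f u ≡ false) → count f xs ≡ 0
  count-zero [] _ = refl
  count-zero (x ∷ xs) none =
    cong₂ _+_ (cong indicator (none x (here refl))) (count-zero xs (λ u u∈xs → none u (there u∈xs)))

  count-≤1 : ∀ {f xs} → Unique xs → (∀ u v → f u ≡ true → f v ≡ true → u ≡ v) → count f xs ≤ 1
  count-≤1 {xs = []} _ _ = z≤n
  count-≤1 {f} {x ∷ xs} (x∉xs ∷ unique) atMostOne with f x in fx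
  ... | true = ≤-reflexive (cong suc (count-zero xs λ u u∈xs →
                 ¬-not (λ fu → All.lookup x∉xs u∈xs (atMostOne x u fx fu))))
  ... | false = count-≤1 unique atMostOne

  count-∨ : ∀ {f g} → (∀ u → f u ∧ g u ≡ false) → ∀ xs →
            count (λ u → f u ∨ g u) xs ≡ count f xs + count g xs
  count-∨ disjoint [] = refl
  count-∨ {f} {g} disjoint (x ∷ xs) =
    trans (cong₂ _+_ (indicator-∨ (f x) (g x) (disjoint x)) (count-∨ disjoint xs))
          (interchange (indicator (f x)) (indicator (g x)) (count f xs) (count g xs))

module _ {n : ℕ} (G : Graph n) where
  open Graph G renaming (sym to adj-sym)

  Adj-sym : ∀ {x y} → Adj G x y → Adj G y x
  Adj-sym {x} {y} a = trans (adj-sym y x) a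

  Adj⇒≢ : ∀ {x y} → Adj G x y → x ≢ y
  Adj⇒≢ {x} x~y refl = contradiction (trans (sym (irrefl x)) x~y) λ ()

  ¬¬Adj⇒Adj : ∀ {x y} → ¬ ¬ Adj G x y → Adj G x y
  ¬¬Adj⇒Adj {x} {y} = decidable-stable (adj x y Bool.≟ true)

  closedNbhd-≢ : ∀ {v u} → InClosedNbhd G v u → u ≢ v → Adj G v u
  closedNbhd-≢ (inj₁ u≡v) u≢v = contradiction u≡v u≢v
  closedNbhd-≢ (inj₂ a) _ = a

  inClosedNbhdᵇ : Fin n → Fin n → Bool
  inClosedNbhdᵇ v u = does (u ≟ v) ∨ adj v u

  inClosedNbhdᵇ⁺ : ∀ {v u} → InClosedNbhd G v u → inClosedNbhdᵇ v u ≡ true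
  inClosedNbhdᵇ⁺ {v} (inj₁ refl) = cong (_∨ adj v v) (dec-true (v ≟ v) refl)
  inClosedNbhdᵇ⁺ {v} {u} (inj₂ a) = trans (cong (does (u ≟ v) ∨_) a) (∨-zeroʳ _)

  inClosedNbhdᵇ⁻ : ∀ {v u} → inClosedNbhdᵇ v u ≡ true → InClosedNbhd G v u
  inClosedNbhdᵇ⁻ {v} {u} b with u ≟ v
  ... | yes u≡v = inj₁ u≡v
  ... | no _ = inj₂ b

  count-inClosedNbhdᵇ : ∀ v → count (inClosedNbhdᵇ v) (allFin n) ≡ suc (degree G v)
  count-inClosedNbhdᵇ v =
    trans (count-∨ disjoint (allFin n)) (cong (_+ degree G v) count-≟)
    where
    disjoint : ∀ u → does (u ≟ v) ∧ adj v u ≡ false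
    disjoint u with u ≟ v
    ... | yes refl = irrefl u
    ... | no _ = refl

    count-≟ : count (λ u → does (u ≟ v)) (allFin n) ≡ 1
    count-≟ = ≤-antisym
      (count-≤1 (allFin⁺ n) λ u w p q → trans (does-true⁻ (u ≟ v) p) (sym (does-true⁻ (w ≟ v) q)))
      (count-pos (∈-allFin v) (dec-true (v ≟ v) refl))

  degree-<-of-⊂ : ∀ {w v b} → (∀ u → InClosedNbhd G w u → InClosedNbhd G v u) →
                  InClosedNbhd G v b → ¬ InClosedNbhd G w b → degree G w < degree G v
  degree-<-of-⊂ {w} {v} {b} w⊆v b∈v b∉w =
    s<s⁻¹ (subst₂ _<_ (count-inClosedNbhdᵇ w) (count-inClosedNbhdᵇ v)
      (count-< (λ u p → inClosedNbhdᵇ⁺ (w⊆v u (inClosedNbhdᵇ⁻ p))) (∈-allFin b)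
               (¬-not (λ p → b∉w (inClosedNbhdᵇ⁻ p))) (inClosedNbhdᵇ⁺ b∈v)))

  simplicial⁺ : ∀ {v} → (∀ x y → Adj G v x → Adj G v y → x ≢ y → ¬ ¬ Adj G x y) → Simplicial G v
  simplicial⁺ open-pair x y (inj₁ refl) (inj₁ refl) x≢y = contradiction refl x≢y
  simplicial⁺ open-pair x y (inj₁ refl) (inj₂ a) _ = a
  simplicial⁺ open-pair x y (inj₂ a) (inj₁ refl) _ = Adj-sym a
  simplicial⁺ open-pair x y (inj₂ a) (inj₂ b) x≢y = ¬¬Adj⇒Adj (open-pair x y a b x≢y)

  simplicial-closedNbhd-⊆ : ∀ {w v} → Simplicial G w → InClosedNbhd G w v →
                            ∀ u → InClosedNbhd G w u → InClosedNbhd G v u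
  simplicial-closedNbhd-⊆ {w} {v} simplicial v∈w u u∈w with u ≟ v
  ... | yes u≡v = inj₁ u≡v
  ... | no u≢v = inj₂ (simplicial v u v∈w u∈w (λ v≡u → u≢v (sym v≡u)))

  _⊆_ : VSet G → VSet G → Set
  T ⊆ T′ = ∀ u → T u ≡ true → T′ u ≡ true

  Stable : VSet G → Set
  Stable T = ∀ a b → T a ≡ true → T b ≡ true → ¬ Adj G a b

  Dominated : VSet G → Fin n → Set
  Dominated T w = T w ≡ true ⊎ ∃ λ u → T u ≡ true × Adj G w u

  DominatedAvoiding : VSet G → Fin n → Fin n → Set
  DominatedAvoiding T v w = T w ≡ true ⊎ ∃ λ u → T u ≡ true × Adj G w u × u ≢ v

  Dominated-mono : ∀ {T T′ w} → T ⊆ T′ → Dominated T w → Dominated T′ w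
  Dominated-mono T⊆T′ (inj₁ tw) = inj₁ (T⊆T′ _ tw)
  Dominated-mono T⊆T′ (inj₂ (u , tu , a)) = inj₂ (u , T⊆T′ u tu , a)

  DominatedAvoiding-mono : ∀ {T T′ v w} → T ⊆ T′ → DominatedAvoiding T v w → DominatedAvoiding T′ v w
  DominatedAvoiding-mono T⊆T′ (inj₁ tw) = inj₁ (T⊆T′ _ tw)
  DominatedAvoiding-mono T⊆T′ (inj₂ (u , tu , a , u≢v)) = inj₂ (u , T⊆T′ u tu , a , u≢v)

  hasNbrIn-true : ∀ {T x} → hasNbrIn G T x ≡ true → ∃ λ u → T u ≡ true × Adj G x u
  hasNbrIn-true {T} {x} e with satisfied (any⁻ (λ u → T u ∧ adj x u) (allFin n) (Equivalence.from T-≡ e))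
  ... | u , t = u , ∧-true⁻ (Equivalence.to T-≡ t)

  hasNbrIn-false : ∀ {T x u} → hasNbrIn G T x ≡ false → T u ≡ true → ¬ Adj G x u
  hasNbrIn-false {T} {x} {u} e tu a = contradiction (trans (sym has) e) λ ()
    where
    has : hasNbrIn G T x ≡ true
    has = Equivalence.to T-≡
      (any⁺ (λ u → T u ∧ adj x u) (lose (∈-allFin u) (Equivalence.from T-≡ (∧-true⁺ tu a))))

  insert-⊇ : ∀ {T x} → T ⊆ insert G T x
  insert-⊇ {T} {x} u tu = cong (λ b → if b then true else does (u ≟ x)) tu

  insert-∋ : ∀ {T x} → insert G T x x ≡ true
  insert-∋ {T} {x} with T x
  ... | true = refl
  ... | false = dec-true (x ≟ x) refl

  insert⁻ : ∀ {T x u} → insert G T x u ≡ true → T u ≡ true ⊎ u ≡ x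
  insert⁻ {T} {x} {u} t with T u
  ... | true = inj₁ refl
  ... | false = inj₂ (does-true⁻ (u ≟ x) t)

  Stable-insert : ∀ {T x} → Stable T → (∀ u → T u ≡ true → ¬ Adj G x u) → Stable (insert G T x)
  Stable-insert {T} {x} stable isolated a b ta tb with insert⁻ {T} ta | insert⁻ {T} tb
  ... | inj₁ ta′ | inj₁ tb′ = stable a b ta′ tb′
  ... | inj₂ refl | inj₁ tb′ = isolated b tb′
  ... | inj₁ ta′ | inj₂ refl = λ a~x → isolated a ta′ (Adj-sym a~x)
  ... | inj₂ refl | inj₂ refl = λ a~a → Adj⇒≢ a~a refl

  record GreedyInvariant (T : VSet G) (pending : List (Fin n)) : Set where
    field
      stable : Stable T
      dominated-or-pending : ∀ w → Dominated T w ⊎ w ∈ pending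
      lowerDegree-dominated : ∀ v w → T v ≡ true → degree G w < degree G v → w ≢ v →
                              DominatedAvoiding T v w

  open GreedyInvariant

  GreedyInvariant-resp : ∀ {T T′ pending} → T ⊆ T′ → T′ ⊆ T →
                         GreedyInvariant T pending → GreedyInvariant T′ pending
  GreedyInvariant-resp T⊆T′ T′⊆T inv = record
    { stable = λ a b ta tb → stable inv a b (T′⊆T a ta) (T′⊆T b tb)
    ; dominated-or-pending = λ w → map₁ (Dominated-mono T⊆T′) (dominated-or-pending inv w)
    ; lowerDegree-dominated = λ v w tv lt w≢v →
        DominatedAvoiding-mono T⊆T′ (lowerDegree-dominated inv v w (T′⊆T v tv) lt w≢v)
    }

  GreedyInvariant-start : ∀ {σ} → σ ↭ allFin n → GreedyInvariant (∅ G) σ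
  GreedyInvariant-start σ↭ = record
    { stable = λ _ _ ()
    ; dominated-or-pending = λ w → inj₂ (∈-resp-↭ (↭-sym σ↭) (∈-allFin w))
    ; lowerDegree-dominated = λ _ _ ()
    }

  GreedyInvariant-skip : ∀ {T x rest} → hasNbrIn G T x ≡ true →
                         GreedyInvariant T (x ∷ rest) → GreedyInvariant T rest
  GreedyInvariant-skip {T} e inv = record
    { stable = stable inv
    ; dominated-or-pending = dominated
    ; lowerDegree-dominated = lowerDegree-dominated inv
    }
    where
    dominated : ∀ w → Dominated T w ⊎ w ∈ _
    dominated w with dominated-or-pending inv w
    ... | inj₁ d = inj₁ d
    ... | inj₂ (here refl) = inj₁ (inj₂ (hasNbrIn-true e))
    ... | inj₂ (there w∈rest) = inj₂ w∈rest

  GreedyInvariant-insert : ∀ {T x rest} → All (λ w → degree G x ≤ degree G w) rest →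
                           hasNbrIn G T x ≡ false →
                           GreedyInvariant T (x ∷ rest) → GreedyInvariant (insert G T x) rest
  GreedyInvariant-insert {T} {x} {rest} x≤rest e inv = record
    { stable = Stable-insert (stable inv) (λ u tu → hasNbrIn-false e tu)
    ; dominated-or-pending = dominated
    ; lowerDegree-dominated = lowerDegree
    }
    where
    dominated : ∀ w → Dominated (insert G T x) w ⊎ w ∈ rest
    dominated w with dominated-or-pending inv w
    ... | inj₁ d = inj₁ (Dominated-mono insert-⊇ d)
    ... | inj₂ (here refl) = inj₁ (inj₁ (insert-∋ {T}))
    ... | inj₂ (there w∈rest) = inj₂ w∈rest

    below-x : ∀ w → degree G w < degree G x → w ≢ x → DominatedAvoiding (insert G T x) x w
    -- The invariant does not record that x ∉ T, hence the split on T x.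
    below-x w lt w≢x with T x in tx
    ... | true = DominatedAvoiding-mono insert-⊇ (lowerDegree-dominated inv x w tx lt w≢x)
    ... | false with dominated-or-pending inv w
    ...   | inj₁ (inj₁ tw) = inj₁ (insert-⊇ {T} w tw)
    ...   | inj₁ (inj₂ (u , tu , a)) =
            inj₂ (u , insert-⊇ {T} u tu , a , λ { refl → contradiction (trans (sym tx) tu) λ () })
    ...   | inj₂ (here refl) = contradiction refl w≢x
    ...   | inj₂ (there w∈rest) = contradiction lt (≤⇒≯ (All.lookup x≤rest w∈rest))

    lowerDegree : ∀ v w → insert G T x v ≡ true → degree G w < degree G v → w ≢ v →
                  DominatedAvoiding (insert G T x) v w
    lowerDegree v w tv lt w≢v with insert⁻ {T} tv
    ... | inj₁ tv′ = DominatedAvoiding-mono insert-⊇ (lowerDegree-dominated inv v w tv′ lt w≢v)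
    ... | inj₂ refl = below-x w lt w≢v

  GreedyInvariant-greedyStep : ∀ {T x rest} → All (λ w → degree G x ≤ degree G w) rest →
                               GreedyInvariant T (x ∷ rest) → GreedyInvariant (greedyStep G T x) rest
  GreedyInvariant-greedyStep {T} {x} x≤rest inv with hasNbrIn G T x in e
  ... | true = GreedyInvariant-skip e inv
  ... | false = GreedyInvariant-insert x≤rest e inv

  GreedyInvariant-foldl : ∀ {T} rest → AllPairs (λ u v → degree G u ≤ degree G v) rest →
                          GreedyInvariant T rest → GreedyInvariant (foldl (greedyStep G) T rest) []
  GreedyInvariant-foldl [] _ inv = inv
  GreedyInvariant-foldl (x ∷ rest) (x≤rest ∷ sorted) inv =
    GreedyInvariant-foldl rest sorted (GreedyInvariant-greedyStep x≤rest inv)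

  DegreeGreedy⇒GreedyInvariant : ∀ {S} → DegreeGreedy G S → GreedyInvariant S []
  DegreeGreedy⇒GreedyInvariant (σ , σ↭ , sorted , S≡) =
    GreedyInvariant-resp (λ u t → trans (S≡ u) t) (λ u s → trans (sym (S≡ u)) s)
      (GreedyInvariant-foldl σ sorted (GreedyInvariant-start σ↭))

  commonNbr⁻ : ∀ (S : VSet G) {x y v} → S v ∧ adj v x ∧ adj v y ≡ true → S v ≡ true × Adj G v x × Adj G v y
  commonNbr⁻ S t with ∧-true⁻ t
  ... | sv , t′ = sv , ∧-true⁻ t′

  GS-mult-pos : ∀ {S x y v} → S v ≡ true → Adj G v x → Adj G v y → 0 < GS-mult G S x y
  GS-mult-pos {v = v} sv vx vy = count-pos (∈-allFin v) (∧-true⁺ sv (∧-true⁺ vx vy))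

  GS-mult-witness : ∀ {S x y} → 0 < GS-mult G S x y → ∃ λ v → S v ≡ true × Adj G v x × Adj G v y
  GS-mult-witness {S} pos with count-witness (allFin n) pos
  ... | v , t = v , commonNbr⁻ S t

  GS-mult-zero : ∀ {S x y} → (∀ v → S v ≡ true → Simplicial G v) → x ≢ y → ¬ Adj G x y →
                 GS-mult G S x y ≡ 0
  GS-mult-zero {S} {x} {y} simplicial x≢y x≁y = count-zero (allFin n) λ v _ →
    ¬-not λ t → let (sv , vx , vy) = commonNbr⁻ S t in
      x≁y (simplicial v sv x y (inj₂ vx) (inj₂ vy) x≢y)

  GS-mult-≤1 : ∀ {S x y} → DiamondFree G → Stable S → Adj G x y → GS-mult G S x y ≤ 1
  GS-mult-≤1 {S} {x} {y} diamondFree stable x~y = count-≤1 (allFin⁺ n) λ u v p q →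
    let (su , ux , uy) = commonNbr⁻ S p
        (sv , vx , vy) = commonNbr⁻ S q
    in decidable-stable (u ≟ v) λ u≢v → diamondFree x y u v
         (x~y , Adj-sym ux , Adj-sym vx , Adj-sym uy , Adj-sym vy , u≢v , stable u v su sv)

  ∈≢∉ : ∀ {T : VSet G} {u x} → T u ≡ true → T x ≡ false → u ≢ x
  ∈≢∉ tu tx refl = contradiction (trans (sym tu) tx) λ ()

  GreedyInvariant-dominating : ∀ {T} → GreedyInvariant T [] → ∀ w → Dominated T w
  GreedyInvariant-dominating inv w with dominated-or-pending inv w
  ... | inj₁ d = d

  module _ {S : VSet G} (es : EdgeSimplicial G) where

    lowerDegree-dominated⇒simplicial : Stable S →
      (∀ v w → S v ≡ true → degree G w < degree G v → w ≢ v → DominatedAvoiding S v w) →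
      ∀ v → S v ≡ true → Simplicial G v
    lowerDegree-dominated⇒simplicial stable dominated v sv = simplicial⁺ open-pair
      where
      open-pair : ∀ x y → Adj G v x → Adj G v y → x ≢ y → ¬ ¬ Adj G x y
      open-pair x y vx vy x≢y x≁y with es v x vx
      ... | w , simplicial-w , v∈w , x∈w =
        absurd (dominated v w sv (degree-<-of-⊂ w⊆v (inj₂ vy) y∉w) w≢v)
        where
        w⊆v : ∀ u → InClosedNbhd G w u → InClosedNbhd G v u
        w⊆v = simplicial-closedNbhd-⊆ simplicial-w v∈w

        y∉w : ¬ InClosedNbhd G w y
        y∉w y∈w = x≁y (simplicial-w x y x∈w y∈w x≢y)

        w≢v : w ≢ v
        w≢v refl = y∉w (inj₂ vy)

        absurd : ¬ DominatedAvoiding S v w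
        absurd (inj₁ sw) = stable v w sv sw (closedNbhd-≢ (w⊆v w (inj₁ refl)) w≢v)
        absurd (inj₂ (u , su , wu , u≢v)) = stable v u sv su (closedNbhd-≢ (w⊆v u (inj₂ wu)) u≢v)

    commonNbr-in-dominating : (∀ w → Dominated S w) → ∀ {x y} → Adj G x y →
      S x ≡ false → S y ≡ false → ∃ λ v → S v ≡ true × Adj G v x × Adj G v y
    commonNbr-in-dominating dominating {x} {y} x~y sx sy with es x y x~y
    ... | w , simplicial-w , x∈w , y∈w with dominating w
    ...   | inj₁ sw = w , sw , closedNbhd-≢ x∈w (≢-sym (∈≢∉ sw sx)) , closedNbhd-≢ y∈w (≢-sym (∈≢∉ sw sy))
    ...   | inj₂ (u , su , wu) = u , su , simplicial-w u x (inj₂ wu) x∈w (∈≢∉ su sx)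
                                       , simplicial-w u y (inj₂ wu) y∈w (∈≢∉ su sy)

    edgeSimplicial⇒GS≡G-S : DiamondFree G → GreedyInvariant S [] → GS≡G-S G S
    edgeSimplicial⇒GS≡G-S diamondFree inv x y sx sy x≢y with adj x y in x~y
    ... | false = GS-mult-zero simplicial x≢y (λ x~y′ → contradiction (trans (sym x~y) x~y′) λ ())
      where
      simplicial : ∀ v → S v ≡ true → Simplicial G v
      simplicial = lowerDegree-dominated⇒simplicial (stable inv) (lowerDegree-dominated inv)
    ... | true with commonNbr-in-dominating (GreedyInvariant-dominating inv) x~y sx sy
    ...   | v , sv , vx , vy = ≤-antisym (GS-mult-≤1 diamondFree (stable inv) x~y) (GS-mult-pos {S} sv vx vy)

  module _ {S : VSet G} (stable : Stable S) (gs : GS≡G-S G S) where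

    GS≡G-S⇒simplicial : ∀ v → S v ≡ true → Simplicial G v
    GS≡G-S⇒simplicial v sv = simplicial⁺ λ x y vx vy x≢y x≁y →
      ≤⇒≯ (≤-reflexive (trans (gs x y (outside vx) (outside vy) x≢y) (cong indicator (¬-not x≁y))))
          (GS-mult-pos {S} sv vx vy)
      where
      outside : ∀ {u} → Adj G v u → S u ≡ false
      outside {u} vu = ¬-not λ su → stable v u sv su vu

    GS≡G-S⇒edgeSimplicial : EdgeSimplicial G
    GS≡G-S⇒edgeSimplicial x y x~y with S x in sx | S y in sy
    ... | true | _ = x , GS≡G-S⇒simplicial x sx , inj₁ refl , inj₂ x~y
    ... | false | true = y , GS≡G-S⇒simplicial y sy , inj₂ (Adj-sym x~y) , inj₁ refl
    ... | false | false with GS-mult-witness (subst (0 <_) G-S≡GS (s≤s z≤n))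
      where
      G-S≡GS : 1 ≡ GS-mult G S x y
      G-S≡GS = sym (trans (gs x y sx sy (Adj⇒≢ x~y)) (cong indicator x~y))
    ...   | v , sv , vx , vy = v , GS≡G-S⇒simplicial v sv , inj₂ vx , inj₂ vy

lemma10 : (n : ℕ) (G : Graph n) (S : VSet G) → DiamondFree G → DegreeGreedy G S →
    (EdgeSimplicial G ⇔ GS≡G-S G S)
lemma10 n G S diamondFree degreeGreedy =
  mk⇔ (λ es → edgeSimplicial⇒GS≡G-S G es diamondFree inv)
      (GS≡G-S⇒edgeSimplicial G (GreedyInvariant.stable inv))
  where
  inv : GreedyInvariant G S []
  inv = DegreeGreedy⇒GreedyInvariant G degreeGreedy
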